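{- Let $0\le w_1\le w_2$ be integers and let $T\in\mathcal{S}_{w_1,w_2}$, where $\mathcal{S}_{w_1,w_2}$ is defined as follows. If $w_1>0$, $\mathcal{S}_{w_1,w_2}$ consists of: (1) $T((0,0),(w_1,y_1),(0,w_2))$ for integers $y_1\ge0$ with $y_1\le r$, where $r\in\{0,\dots,w_1-1\}$ is the remainder of $w_2-y_1$ modulo $w_1$; (2) $T((0,0),(w_1,y_1),(x_2,w_2))$ for integers $0<x_2\le \frac{w_1}{2}$, $0\le y_1\le w_1-x_2$, with additionally $y_1\ge x_2$ if $w_1=w_2$; (3) when $w_1<w_2$, $T((0,y_0),(w_1,0),(x_2,w_2))$ for integers $1<x_2<\frac{w_1}{2}$, $0<y_0<x_2$. If $w_1=0$, $\mathcal{S}_{0,w_2}=\{T((0,0),(0,y_1),(0,w_2)): y_1\in\mathbb{Z},\ 0\le y_1\le\frac{w_2}{2}\}$. Then the first width of $T$ is $w_1$ and the second width of $T$ is $w_2$.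
   Context: $T(v_1,v_2,v_3)$ denotes the convex hull of $v_1,v_2,v_3\in\mathbb{Z}^2$ (possibly degenerate). For $u\in(\mathbb{Z}^2)^*$, $\operatorname{width}_u(T)=\max_{x\in T}u\cdot x-\min_{x\in T}u\cdot x$; choosing linearly independent $u_1,u_2\in(\mathbb{Z}^2)^*$ minimizing $(\operatorname{width}_{u_1}(T),\operatorname{width}_{u_2}(T))$ in lexicographic order, the first width of $T$ is $\operatorname{width}_{u_1}(T)$ and the second width is $\operatorname{width}_{u_2}(T)$. -}

module Defs where

open import Data.Integer using (ℤ; +_; 0ℤ; 1ℤ; _+_; _-_; _*_; _⊔_; _⊓_; _≤_; _<_; >-nonZero)
open import Data.Integer.DivMod using (_%_)
open import Data.Product using (Σ; _×_; _,_; proj₁; proj₂)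
open import Data.Sum using (_⊎_)
open import Relation.Binary.PropositionalEquality using (_≡_; _≢_)

Point : Set
Point = ℤ × ℤ

Functional : Set
Functional = ℤ × ℤ

_·_ : Functional → Point → ℤ
(a , b) · (x , y) = a * x + b * y

-- T(v1,v2,v3), recorded by its three vertices (possibly degenerate)
Triangle : Set
Triangle = Point × Point × Point

-- width_u(T) = max_{x∈T} u·x − min_{x∈T} u·x ; since u·x is linear, the
-- max/min over the convex hull are attained at vertices.
width : Functional → Triangle → ℤ
width u (v1 , v2 , v3) =
  ((u · v1) ⊔ (u · v2) ⊔ (u · v3)) - ((u · v1) ⊓ (u · v2) ⊓ (u · v3))

LinIndep : Functional → Functional → Set
LinIndep (a , b) (c , d) = a * d - b * c ≢ 0ℤ

_≤lex_ : ℤ × ℤ → ℤ × ℤ → Set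
(a , b) ≤lex (c , d) = (a < c) ⊎ ((a ≡ c) × (b ≤ d))

FirstSecondWidths : Triangle → ℤ → ℤ → Set
FirstSecondWidths T w1 w2 =
  Σ Functional λ u1 → Σ Functional λ u2 →
    LinIndep u1 u2 × width u1 T ≡ w1 × width u2 T ≡ w2 ×
    ((v1 v2 : Functional) → LinIndep v1 v2 →
       (w1 , w2) ≤lex (width v1 T , width v2 T))

data InS (w1 w2 : ℤ) : Triangle → Set where
  fam1 : (pos : 0ℤ < w1) (y1 : ℤ) → 0ℤ ≤ y1 →
         y1 ≤ + (_%_ (w2 - y1) w1 {{>-nonZero pos}}) →
         InS w1 w2 ((0ℤ , 0ℤ) , (w1 , y1) , (0ℤ , w2))
  fam2 : 0ℤ < w1 → (x2 y1 : ℤ) → 0ℤ < x2 → (+ 2) * x2 ≤ w1 →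
         0ℤ ≤ y1 → y1 ≤ w1 - x2 → (w1 ≡ w2 → x2 ≤ y1) →
         InS w1 w2 ((0ℤ , 0ℤ) , (w1 , y1) , (x2 , w2))
  fam3 : 0ℤ < w1 → w1 < w2 → (x2 y0 : ℤ) → 1ℤ < x2 → (+ 2) * x2 < w1 →
         0ℤ < y0 → y0 < x2 →
         InS w1 w2 ((0ℤ , y0) , (w1 , 0ℤ) , (x2 , w2))
  fam0 : w1 ≡ 0ℤ → (y1 : ℤ) → 0ℤ ≤ y1 → (+ 2) * y1 ≤ w2 →
         InS w1 w2 ((0ℤ , 0ℤ) , (0ℤ , y1) , (0ℤ , w2))

{-# OPTIONS --safe #-}
-- The coordinate functionals e₁ = (1,0) and e₂ = (0,1) have widths w₁ and w₂ on T. By the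
-- symmetry u ↦ -u of widths, minimality of (w₁, w₂) reduces to two lower bounds: w₁ for
-- every (a,0) with a ≠ 0, and w₂ for every (a,b) with b > 0 (a linearly independent pair
-- always contains a functional with b ≠ 0). Each bound is witnessed by a single pair of
-- vertices p, q, chosen according to the sign of a, for which u·p - u·q ≥ the bound
-- follows from the inequalities defining the family.
module Submission where

open import Defs
open import Data.Integer using (ℤ; 0ℤ; _≤_)
open import Data.Integer.Base using (+_; +[1+_]; -[1+_]; 1ℤ; nonNegative; _+_; _-_; _*_; -_; _⊔_; _⊓_; _<_; +≤+; +<+; >-nonZero)
open import Data.Integer.Properties
open import Data.Integer.DivMod using (_%_; n%d<d)
open import Data.Integer.Tactic.RingSolver using (solve-∀)
open import Data.Nat.Base using (s≤s; z≤n)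
open import Data.Product using (_,_)
open import Data.Sum using (inj₁; inj₂)
open import Data.Empty using (⊥-elim)
open import Relation.Binary.PropositionalEquality
open import Relation.Nullary using (yes; no)
open import Algebra.Properties.CommutativeSemigroup ⊔-commutativeSemigroup as ⊔ using ()
open import Algebra.Properties.CommutativeSemigroup ⊓-commutativeSemigroup as ⊓ using ()

1≤+[1+n] : ∀ n → 1ℤ ≤ +[1+ n ]
1≤+[1+n] _ = +≤+ (s≤s z≤n)

x≤k*x : ∀ {k x} → 1ℤ ≤ k → 0ℤ ≤ x → x ≤ k * x
x≤k*x {k} {x} 1≤k 0≤x = subst (_≤ k * x) (*-identityˡ x) (*-monoʳ-≤-nonNeg x {{nonNegative 0≤x}} 1≤k)

x≤2*x : ∀ {x} → 0ℤ ≤ x → x ≤ + 2 * x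
x≤2*x = x≤k*x {+ 2} (+≤+ (s≤s z≤n))

0≤k*x : ∀ {k x} → 0ℤ ≤ k → 0ℤ ≤ x → 0ℤ ≤ k * x
0≤k*x {k} {x} 0≤k 0≤x = *-monoʳ-≤-nonNeg x {{nonNegative 0≤x}} 0≤k

y≤kx+by : ∀ {k b x y} → 0ℤ ≤ k → 1ℤ ≤ b → 0ℤ ≤ x → 0ℤ ≤ y → y ≤ k * x + b * y
y≤kx+by {k} {b} {x} {y} 0≤k 1≤b 0≤x 0≤y =
  ≤-trans (x≤k*x 1≤b 0≤y) (i≤j+i (b * y) (k * x) {{nonNegative (0≤k*x 0≤k 0≤x)}})

x+y≤kx+by : ∀ {k b x y} → 1ℤ ≤ k → 1ℤ ≤ b → 0ℤ ≤ x → 0ℤ ≤ y → x + y ≤ k * x + b * y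
x+y≤kx+by 1≤k 1≤b 0≤x 0≤y = +-mono-≤ (x≤k*x 1≤k 0≤x) (x≤k*x 1≤b 0≤y)

j≤i+[j-k] : ∀ {i j k} → k ≤ i → j ≤ i + (j - k)
j≤i+[j-k] {i} {j} {k} k≤i = begin
  j               ≤⟨ i≤i+j j (i - k) {{nonNegative (i≤j⇒0≤j-i k≤i)}} ⟩
  j + (i - k)     ≡⟨ regroup i j k ⟩
  i + (j - k)     ∎
  where
  open ≤-Reasoning
  regroup : ∀ i j k → j + (i - k) ≡ i + (j - k)
  regroup = solve-∀

+[i%d]<d : ∀ i d (0<d : 0ℤ < d) → + (_%_ i d {{>-nonZero 0<d}}) < d
+[i%d]<d i d 0<d = subst (+ (_%_ i d {{>-nonZero 0<d}}) <_) (0≤i⇒+∣i∣≡i (<⇒≤ 0<d)) (+<+ (n%d<d i d {{>-nonZero 0<d}}))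

range : ℤ → ℤ → ℤ → ℤ
range a b c = (a ⊔ b ⊔ c) - (a ⊓ b ⊓ c)

range-cong : ∀ {a a′ b b′ c c′} → a ≡ a′ → b ≡ b′ → c ≡ c′ → range a b c ≡ range a′ b′ c′
range-cong refl refl refl = refl

range-comm₁₂ : ∀ a b c → range a b c ≡ range b a c
range-comm₁₂ a b c = cong₂ _-_ (cong (_⊔ c) (⊔-comm a b)) (cong (_⊓ c) (⊓-comm a b))

range-comm₂₃ : ∀ a b c → range a b c ≡ range a c b
range-comm₂₃ a b c = cong₂ _-_ (⊔.xy∙z≈xz∙y a b c) (⊓.xy∙z≈xz∙y a b c)

range-0hz : ∀ {h z} → 0ℤ ≤ z → z ≤ h → range 0ℤ h z ≡ h
range-0hz {h} {z} 0≤z z≤h = begin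
  (0ℤ ⊔ h ⊔ z) - (0ℤ ⊓ h ⊓ z)  ≡⟨ cong₂ (λ s t → (s ⊔ z) - (t ⊓ z)) (i≤j⇒i⊔j≡j 0≤h) (i≤j⇒i⊓j≡i 0≤h) ⟩
  (h ⊔ z) - (0ℤ ⊓ z)           ≡⟨ cong₂ _-_ (i≥j⇒i⊔j≡i z≤h) (i≤j⇒i⊓j≡i 0≤z) ⟩
  h - 0ℤ                       ≡⟨ +-identityʳ h ⟩
  h                            ∎
  where
  open ≡-Reasoning
  0≤h = ≤-trans 0≤z z≤h

range-0zh : ∀ {h z} → 0ℤ ≤ z → z ≤ h → range 0ℤ z h ≡ h
range-0zh {h} {z} 0≤z z≤h = trans (range-comm₂₃ 0ℤ z h) (range-0hz 0≤z z≤h)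

range-z0h : ∀ {h z} → 0ℤ ≤ z → z ≤ h → range z 0ℤ h ≡ h
range-z0h {h} {z} 0≤z z≤h = trans (range-comm₁₂ z 0ℤ h) (range-0zh 0≤z z≤h)

range-neg : ∀ a b c → range (- a) (- b) (- c) ≡ range a b c
range-neg a b c = begin
  (- a ⊔ - b ⊔ - c) - (- a ⊓ - b ⊓ - c)
    ≡⟨ cong₂ (λ s t → (s ⊔ - c) - (t ⊓ - c)) (sym (neg-distrib-⊓-⊔ a b)) (sym (neg-distrib-⊔-⊓ a b)) ⟩
  (- (a ⊓ b) ⊔ - c) - (- (a ⊔ b) ⊓ - c)
    ≡⟨ cong₂ _-_ (sym (neg-distrib-⊓-⊔ (a ⊓ b) c)) (sym (neg-distrib-⊔-⊓ (a ⊔ b) c)) ⟩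
  - (a ⊓ b ⊓ c) - - (a ⊔ b ⊔ c)
    ≡⟨ neg-sub-neg (a ⊓ b ⊓ c) (a ⊔ b ⊔ c) ⟩
  (a ⊔ b ⊔ c) - (a ⊓ b ⊓ c) ∎
  where
  open ≡-Reasoning
  neg-sub-neg : ∀ m M → - m - - M ≡ M - m
  neg-sub-neg = solve-∀

data _∈ᵥ_ (p : Point) : Triangle → Set where
  vertex₁ : ∀ {q r} → p ∈ᵥ (p , q , r)
  vertex₂ : ∀ {q r} → p ∈ᵥ (q , p , r)
  vertex₃ : ∀ {q r} → p ∈ᵥ (q , r , p)

·-≤-max : ∀ u {p p₁ p₂ p₃} → p ∈ᵥ (p₁ , p₂ , p₃) → u · p ≤ u · p₁ ⊔ u · p₂ ⊔ u · p₃
·-≤-max u {_} {p₁} {p₂} {p₃} vertex₁ = ≤-trans (i≤i⊔j (u · p₁) (u · p₂)) (i≤i⊔j _ (u · p₃))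
·-≤-max u {_} {p₁} {p₂} {p₃} vertex₂ = ≤-trans (i≤j⊔i (u · p₁) (u · p₂)) (i≤i⊔j _ (u · p₃))
·-≤-max u {_} {p₁} {p₂} {p₃} vertex₃ = i≤j⊔i (u · p₁ ⊔ u · p₂) (u · p₃)

min-≤-· : ∀ u {p p₁ p₂ p₃} → p ∈ᵥ (p₁ , p₂ , p₃) → u · p₁ ⊓ u · p₂ ⊓ u · p₃ ≤ u · p
min-≤-· u {_} {p₁} {p₂} {p₃} vertex₁ = ≤-trans (i⊓j≤i _ (u · p₃)) (i⊓j≤i (u · p₁) (u · p₂))
min-≤-· u {_} {p₁} {p₂} {p₃} vertex₂ = ≤-trans (i⊓j≤i _ (u · p₃)) (i⊓j≤j (u · p₁) (u · p₂))
min-≤-· u {_} {p₁} {p₂} {p₃} vertex₃ = i⊓j≤j (u · p₁ ⊓ u · p₂) (u · p₃)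

≤-width : ∀ u T {p q w} → p ∈ᵥ T → q ∈ᵥ T → w ≤ u · p - u · q → w ≤ width u T
≤-width u (_ , _ , _) p∈T q∈T w≤ =
  ≤-trans w≤ (+-mono-≤ (·-≤-max u p∈T) (neg-mono-≤ (min-≤-· u q∈T)))

width-nonneg : ∀ u T → 0ℤ ≤ width u T
width-nonneg u T@(p , _ , _) = ≤-width u T vertex₁ vertex₁ (≤-reflexive (sym (+-inverseʳ (u · p))))

·-neg : ∀ a b p → (- a , - b) · p ≡ - ((a , b) · p)
·-neg a b (x , y) = neg-lincomb a b x y
  where
  neg-lincomb : ∀ a b x y → (- a) * x + (- b) * y ≡ - (a * x + b * y)
  neg-lincomb = solve-∀

width-neg : ∀ a b T → width (- a , - b) T ≡ width (a , b) T
width-neg a b (p , q , r) =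
  trans (range-cong (·-neg a b p) (·-neg a b q) (·-neg a b r)) (range-neg ((a , b) · p) ((a , b) · q) ((a , b) · r))

e₁ e₂ : Functional
e₁ = 1ℤ , 0ℤ
e₂ = 0ℤ , 1ℤ

width-e₁ : ∀ x₁ y₁ x₂ y₂ x₃ y₃ → width e₁ ((x₁ , y₁) , (x₂ , y₂) , (x₃ , y₃)) ≡ range x₁ x₂ x₃
width-e₁ x₁ y₁ x₂ y₂ x₃ y₃ = range-cong (e₁-· x₁ y₁) (e₁-· x₂ y₂) (e₁-· x₃ y₃)
  where
  e₁-· : ∀ x y → 1ℤ * x + 0ℤ * y ≡ x
  e₁-· = solve-∀

width-e₂ : ∀ x₁ y₁ x₂ y₂ x₃ y₃ → width e₂ ((x₁ , y₁) , (x₂ , y₂) , (x₃ , y₃)) ≡ range y₁ y₂ y₃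
width-e₂ x₁ y₁ x₂ y₂ x₃ y₃ = range-cong (e₂-· x₁ y₁) (e₂-· x₂ y₂) (e₂-· x₃ y₃)
  where
  e₂-· : ∀ x y → 0ℤ * x + 1ℤ * y ≡ y
  e₂-· = solve-∀

HorizontalWidths≥ : ℤ → Triangle → Set
HorizontalWidths≥ w T = ∀ a → a ≢ 0ℤ → w ≤ width (a , 0ℤ) T

NonHorizontalWidths≥ : ℤ → Triangle → Set
NonHorizontalWidths≥ w T = ∀ a b → b ≢ 0ℤ → w ≤ width (a , b) T

horizontalWidths≥-fromPositive : ∀ {w T} →
  (∀ n → w ≤ width (+[1+ n ] , 0ℤ) T) → HorizontalWidths≥ w T
horizontalWidths≥-fromPositive h (+ 0)    a≢0 = ⊥-elim (a≢0 refl)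
horizontalWidths≥-fromPositive h +[1+ n ] _   = h n
horizontalWidths≥-fromPositive {w} {T} h -[1+ n ] _ =
  subst (w ≤_) (sym (width-neg +[1+ n ] 0ℤ T)) (h n)

nonHorizontalWidths≥-fromPositive : ∀ {w T} →
  (∀ a n → w ≤ width (a , +[1+ n ]) T) → NonHorizontalWidths≥ w T
nonHorizontalWidths≥-fromPositive h a (+ 0)    b≢0 = ⊥-elim (b≢0 refl)
nonHorizontalWidths≥-fromPositive h a +[1+ n ] _   = h a n
nonHorizontalWidths≥-fromPositive {w} {T} h a -[1+ n ] _ =
  subst (λ a′ → w ≤ width (a′ , -[1+ n ]) T) (neg-involutive a)
    (subst (w ≤_) (sym (width-neg (- a) +[1+ n ] T)) (h (- a) n))

LinIndep⇒nonzeroˡ : ∀ u v → LinIndep u v → u ≢ (0ℤ , 0ℤ)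
LinIndep⇒nonzeroˡ _ _ li refl = li refl

LinIndep⇒nonzeroʳ : ∀ u v → LinIndep u v → v ≢ (0ℤ , 0ℤ)
LinIndep⇒nonzeroʳ (a , b) _ li refl = li (cong₂ _-_ (*-zeroʳ a) (*-zeroʳ b))

nonzero⇒width≥ : ∀ {w₁ w₂ T} → w₁ ≤ w₂ → HorizontalWidths≥ w₁ T → NonHorizontalWidths≥ w₂ T →
  ∀ a b → (a , b) ≢ (0ℤ , 0ℤ) → w₁ ≤ width (a , b) T
nonzero⇒width≥ w₁≤w₂ hor nonHor a b u≢0 with b ≟ 0ℤ | a ≟ 0ℤ
... | no b≢0   | _        = ≤-trans w₁≤w₂ (nonHor a b b≢0)
... | yes refl | no a≢0   = hor a a≢0
... | yes refl | yes refl = ⊥-elim (u≢0 refl)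

firstSecondWidths-byAxes : ∀ {w₁ w₂ T} → w₁ ≤ w₂ → width e₁ T ≡ w₁ → width e₂ T ≡ w₂ →
  HorizontalWidths≥ w₁ T → NonHorizontalWidths≥ w₂ T → FirstSecondWidths T w₁ w₂
firstSecondWidths-byAxes {w₁} {w₂} {T} w₁≤w₂ e₁-width e₂-width hor nonHor =
  e₁ , e₂ , (λ ()) , e₁-width , e₂-width , minimal
  where
  minimal : ∀ u v → LinIndep u v → (w₁ , w₂) ≤lex (width u T , width v T)
  minimal (a , b) (c , d) li with w₁ <? width (a , b) T
  ... | yes w₁<width = inj₁ w₁<width
  ... | no  w₁≮width = inj₂ (w₁≡width , w₂≤width)
    where
    w₁≡width : w₁ ≡ width (a , b) T
    w₁≡width = ≤-antisym (nonzero⇒width≥ w₁≤w₂ hor nonHor a b (LinIndep⇒nonzeroˡ (a , b) (c , d) li)) (≮⇒≥ w₁≮width)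
    -- If v is horizontal, then u is not, so w₂ ≤ width u T = w₁ ≤ width v T.
    w₂≤width : w₂ ≤ width (c , d) T
    w₂≤width with d ≟ 0ℤ | b ≟ 0ℤ
    ... | no d≢0   | _        = nonHor c d d≢0
    ... | yes refl | no b≢0   = ≤-trans (nonHor a b b≢0)
      (≤-trans (≤-reflexive (sym w₁≡width)) (nonzero⇒width≥ w₁≤w₂ hor nonHor c 0ℤ (LinIndep⇒nonzeroʳ (a , b) (c , 0ℤ) li)))
    ... | yes refl | yes refl = ⊥-elim (li (cong₂ _-_ (*-zeroʳ a) (*-zeroˡ c)))

horizontalWidths≥ : ∀ T {w s t} → 0ℤ ≤ w → (w , t) ∈ᵥ T → (0ℤ , s) ∈ᵥ T → HorizontalWidths≥ w T
horizontalWidths≥ T {w} {s} {t} 0≤w p∈T q∈T = horizontalWidths≥-fromPositive {w} {T} λ n →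
  ≤-width (+[1+ n ] , 0ℤ) T p∈T q∈T (begin
    w                                                    ≤⟨ x≤k*x (1≤+[1+n] n) 0≤w ⟩
    +[1+ n ] * w                                         ≡⟨ expand +[1+ n ] w s t ⟨
    (+[1+ n ] * w + 0ℤ * t) - (+[1+ n ] * 0ℤ + 0ℤ * s)   ∎)
  where
  open ≤-Reasoning
  expand : ∀ k w s t → (k * w + 0ℤ * t) - (k * 0ℤ + 0ℤ * s) ≡ k * w
  expand = solve-∀

-- Families (1) and (2); in family (1), x₂ = 0 and the remainder condition enters only through y₁ < w₁.
widths-origin : ∀ {w₁ w₂ x₂ y₁} → 0ℤ ≤ x₂ → 0ℤ ≤ y₁ → y₁ ≤ w₁ - x₂ → w₁ ≤ w₂ →
  FirstSecondWidths ((0ℤ , 0ℤ) , (w₁ , y₁) , (x₂ , w₂)) w₁ w₂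
widths-origin {w₁} {w₂} {x₂} {y₁} 0≤x₂ 0≤y₁ y₁≤w₁-x₂ w₁≤w₂ =
  firstSecondWidths-byAxes w₁≤w₂
    (trans (width-e₁ 0ℤ 0ℤ w₁ y₁ x₂ w₂) (range-0hz 0≤x₂ x₂≤w₁))
    (trans (width-e₂ 0ℤ 0ℤ w₁ y₁ x₂ w₂) (range-0zh 0≤y₁ y₁≤w₂))
    (horizontalWidths≥ T 0≤w₁ vertex₂ vertex₁)
    (nonHorizontalWidths≥-fromPositive {w₂} {T} slanted)
  where
  T = (0ℤ , 0ℤ) , (w₁ , y₁) , (x₂ , w₂)
  x₂≤w₁ = 0≤i-j⇒j≤i (≤-trans 0≤y₁ y₁≤w₁-x₂)
  0≤w₁ = ≤-trans 0≤x₂ x₂≤w₁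
  y₁≤w₂ = ≤-trans y₁≤w₁-x₂ (≤-trans (i-j≤i w₁ x₂ {{nonNegative 0≤x₂}}) w₁≤w₂)
  0≤w₂ = ≤-trans 0≤w₁ w₁≤w₂
  open ≤-Reasoning
  slanted : ∀ a n → w₂ ≤ width (a , +[1+ n ]) T
  slanted (+ m) n = ≤-width (+ m , +[1+ n ]) T vertex₃ vertex₁ (begin
    w₂                                              ≤⟨ y≤kx+by {+ m} (+≤+ z≤n) (1≤+[1+n] n) 0≤x₂ 0≤w₂ ⟩
    + m * x₂ + +[1+ n ] * w₂                        ≡⟨ expand (+ m) +[1+ n ] x₂ w₂ ⟨
    (+ m * x₂ + +[1+ n ] * w₂) - (+ m * 0ℤ + +[1+ n ] * 0ℤ) ∎)
    where
    expand : ∀ a b x y → (a * x + b * y) - (a * 0ℤ + b * 0ℤ) ≡ a * x + b * y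
    expand = solve-∀
  slanted -[1+ m ] n = ≤-width (-[1+ m ] , +[1+ n ]) T vertex₃ vertex₂ (begin
    w₂                                              ≤⟨ j≤i+[j-k] y₁≤w₁-x₂ ⟩
    (w₁ - x₂) + (w₂ - y₁)                           ≤⟨ x+y≤kx+by (1≤+[1+n] m) (1≤+[1+n] n)
                                                         (i≤j⇒0≤j-i x₂≤w₁) (i≤j⇒0≤j-i y₁≤w₂) ⟩
    +[1+ m ] * (w₁ - x₂) + +[1+ n ] * (w₂ - y₁)     ≡⟨ expand +[1+ m ] +[1+ n ] w₁ w₂ x₂ y₁ ⟨
    (- +[1+ m ] * x₂ + +[1+ n ] * w₂) - (- +[1+ m ] * w₁ + +[1+ n ] * y₁) ∎)
    where
    expand : ∀ k b w₁ w₂ x₂ y₁ → (- k * x₂ + b * w₂) - (- k * w₁ + b * y₁) ≡ k * (w₁ - x₂) + b * (w₂ - y₁)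
    expand = solve-∀

widths-skew : ∀ {w₁ w₂ x₂ y₀} → 0ℤ ≤ y₀ → y₀ ≤ x₂ → x₂ ≤ w₁ → w₁ ≤ w₂ →
  FirstSecondWidths ((0ℤ , y₀) , (w₁ , 0ℤ) , (x₂ , w₂)) w₁ w₂
widths-skew {w₁} {w₂} {x₂} {y₀} 0≤y₀ y₀≤x₂ x₂≤w₁ w₁≤w₂ =
  firstSecondWidths-byAxes w₁≤w₂
    (trans (width-e₁ 0ℤ y₀ w₁ 0ℤ x₂ w₂) (range-0hz 0≤x₂ x₂≤w₁))
    (trans (width-e₂ 0ℤ y₀ w₁ 0ℤ x₂ w₂) (range-z0h 0≤y₀ y₀≤w₂))
    (horizontalWidths≥ T 0≤w₁ vertex₂ vertex₁)
    (nonHorizontalWidths≥-fromPositive {w₂} {T} slanted)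
  where
  T = (0ℤ , y₀) , (w₁ , 0ℤ) , (x₂ , w₂)
  0≤x₂ = ≤-trans 0≤y₀ y₀≤x₂
  0≤w₁ = ≤-trans 0≤x₂ x₂≤w₁
  y₀≤w₂ = ≤-trans y₀≤x₂ (≤-trans x₂≤w₁ w₁≤w₂)
  0≤w₂ = ≤-trans 0≤w₁ w₁≤w₂
  open ≤-Reasoning
  slanted-nonPositive : ∀ k n → 0ℤ ≤ k → w₂ ≤ width (- k , +[1+ n ]) T
  slanted-nonPositive k n 0≤k = ≤-width (- k , +[1+ n ]) T vertex₃ vertex₂ (begin
    w₂                                              ≤⟨ y≤kx+by 0≤k (1≤+[1+n] n) (i≤j⇒0≤j-i x₂≤w₁) 0≤w₂ ⟩
    k * (w₁ - x₂) + +[1+ n ] * w₂                   ≡⟨ expand k +[1+ n ] w₁ w₂ x₂ ⟨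
    (- k * x₂ + +[1+ n ] * w₂) - (- k * w₁ + +[1+ n ] * 0ℤ) ∎)
    where
    expand : ∀ k b w₁ w₂ x₂ → (- k * x₂ + b * w₂) - (- k * w₁ + b * 0ℤ) ≡ k * (w₁ - x₂) + b * w₂
    expand = solve-∀
  slanted : ∀ a n → w₂ ≤ width (a , +[1+ n ]) T
  slanted (+ 0) n = slanted-nonPositive 0ℤ n ≤-refl
  slanted -[1+ m ] n = slanted-nonPositive +[1+ m ] n (+≤+ z≤n)
  slanted +[1+ m ] n = ≤-width (+[1+ m ] , +[1+ n ]) T vertex₃ vertex₁ (begin
    w₂                                              ≤⟨ j≤i+[j-k] y₀≤x₂ ⟩
    x₂ + (w₂ - y₀)                                  ≤⟨ x+y≤kx+by (1≤+[1+n] m) (1≤+[1+n] n) 0≤x₂ (i≤j⇒0≤j-i y₀≤w₂) ⟩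
    +[1+ m ] * x₂ + +[1+ n ] * (w₂ - y₀)            ≡⟨ expand +[1+ m ] +[1+ n ] w₂ x₂ y₀ ⟨
    (+[1+ m ] * x₂ + +[1+ n ] * w₂) - (+[1+ m ] * 0ℤ + +[1+ n ] * y₀) ∎)
    where
    expand : ∀ k b w₂ x₂ y₀ → (k * x₂ + b * w₂) - (k * 0ℤ + b * y₀) ≡ k * x₂ + b * (w₂ - y₀)
    expand = solve-∀

widths-collinear : ∀ {w₂ y₁} → 0ℤ ≤ y₁ → y₁ ≤ w₂ →
  FirstSecondWidths ((0ℤ , 0ℤ) , (0ℤ , y₁) , (0ℤ , w₂)) 0ℤ w₂
widths-collinear {w₂} {y₁} 0≤y₁ y₁≤w₂ =
  firstSecondWidths-byAxes 0≤w₂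
    refl
    (trans (width-e₂ 0ℤ 0ℤ 0ℤ y₁ 0ℤ w₂) (range-0zh 0≤y₁ y₁≤w₂))
    (λ a _ → width-nonneg (a , 0ℤ) T)
    (nonHorizontalWidths≥-fromPositive {w₂} {T} vertical)
  where
  T = (0ℤ , 0ℤ) , (0ℤ , y₁) , (0ℤ , w₂)
  0≤w₂ = ≤-trans 0≤y₁ y₁≤w₂
  open ≤-Reasoning
  vertical : ∀ a n → w₂ ≤ width (a , +[1+ n ]) T
  vertical a n = ≤-width (a , +[1+ n ]) T vertex₃ vertex₁ (begin
    w₂                                              ≤⟨ x≤k*x (1≤+[1+n] n) 0≤w₂ ⟩
    +[1+ n ] * w₂                                   ≡⟨ expand a +[1+ n ] w₂ ⟨
    (a * 0ℤ + +[1+ n ] * w₂) - (a * 0ℤ + +[1+ n ] * 0ℤ) ∎)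
    where
    expand : ∀ a b w₂ → (a * 0ℤ + b * w₂) - (a * 0ℤ + b * 0ℤ) ≡ b * w₂
    expand = solve-∀

proposition3p2 : (w1 w2 : ℤ) → 0ℤ ≤ w1 → w1 ≤ w2 →
    (T : Triangle) → InS w1 w2 T → FirstSecondWidths T w1 w2
proposition3p2 w1 w2 _ w1≤w2 _ (fam1 0<w1 y1 0≤y1 y1≤r) =
  widths-origin ≤-refl 0≤y1 y1≤w1-0 w1≤w2
  where
  y1<w1 : y1 < w1
  y1<w1 = ≤-<-trans y1≤r (+[i%d]<d (w2 - y1) w1 0<w1)
  y1≤w1-0 : y1 ≤ w1 - 0ℤ
  y1≤w1-0 = ≤-trans (<⇒≤ y1<w1) (≤-reflexive (sym (+-identityʳ w1)))
proposition3p2 w1 w2 _ w1≤w2 _ (fam2 _ x2 y1 0<x2 _ 0≤y1 y1≤w1-x2 _) =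
  widths-origin (<⇒≤ 0<x2) 0≤y1 y1≤w1-x2 w1≤w2
proposition3p2 w1 w2 _ w1≤w2 _ (fam3 _ _ x2 y0 _ 2x2<w1 0<y0 y0<x2) =
  widths-skew (<⇒≤ 0<y0) (<⇒≤ y0<x2) (≤-trans (x≤2*x 0≤x2) (<⇒≤ 2x2<w1)) w1≤w2
  where
  0≤x2 = <⇒≤ (<-trans 0<y0 y0<x2)
proposition3p2 .0ℤ w2 _ _ _ (fam0 refl y1 0≤y1 2y1≤w2) =
  widths-collinear 0≤y1 (≤-trans (x≤2*x 0≤y1) 2y1≤w2)
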